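{- Let $D=(V,A)$ be a directed acyclic graph with single source $s$ and unit-capacity arcs, and let $f:A\to\{0,1,\dots,k\}$. If $f$ has a fan-extension, then it has a unique maximal fan-extension $g^*$, that is, a fan-extension $g^*$ with $g^*(v)\ge g(v)$ for every fan-extension $g$ of $f$ and every node $v$.
   Context: Convention: functions $g:V\to\{0,\dots,k\}$ considered satisfy $g(s)=k$ (the source knows all layers). A path with arcs $a_1,\dots,a_r$ is monotone (w.r.t. $f$) if $f(a_1)\le\dots\le f(a_r)$; $\min(P)=f(a_1)$, $\max(P)=f(a_r)$. Given $g:V\to\{0,\dots,k\}$ and $v\ne s$, an $i$-fan of $v$ consists of $i$ pairwise arc-disjoint monotone paths $P_1,\dots,P_i$ with at least one arc each, ending at $v$, such that for all $j\le i$: $j\le\min(P_j)\le\max(P_j)\le i$ and $P_j$ starts at a node $v_j$ with $g(v_j)\ge\min(P_j)$. $g$ is a fan-extension of $f$ if (i) every $v\ne s$ with $g(v)>0$ has a $g(v)$-fan, and (ii) for every arc $vw$, either $f(vw)\le g(v)$ or some arc $uv$ entering $v$ has $f(uv)=f(vw)$. -}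

module Defs where

open import Data.Nat using (ℕ; zero; suc; _≤_; _<_)
open import Data.Fin using (Fin; toℕ)
open import Data.List using (List; []; _∷_)
open import Data.List.Membership.Propositional using (_∈_)
open import Data.List.Relation.Unary.Linked using (Linked)
open import Data.Product using (Σ; ∃; _×_; _,_)
open import Data.Sum using (_⊎_)
open import Data.Empty using (⊥)
open import Relation.Nullary using (¬_)
open import Relation.Binary.PropositionalEquality using (_≡_; _≢_)

-- A directed multigraph on nodes Fin n with arcs Fin m; arc a goes from
-- tl a to hd a.  Parallel arcs are allowed (unit-capacity arcs).
module _ {n m : ℕ} (tl hd : Fin m → Fin n) where

  data Path : Fin n → Fin n → List (Fin m) → Set where
    one  : (a : Fin m) → Path (tl a) (hd a) (a ∷ [])
    cons : (a : Fin m) {v w : Fin n} {as : List (Fin m)} →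
           hd a ≡ v → Path v w as → Path (tl a) w (a ∷ as)

  Acyclic : Set
  Acyclic = ∀ (v : Fin n) (as : List (Fin m)) → ¬ Path v v as

  SingleSource : Fin n → Set
  SingleSource s = (∀ a → hd a ≢ s) × (∀ v → v ≢ s → ∃ λ a → hd a ≡ v)

  firstArc : ∀ {u v as} → Path u v as → Fin m
  firstArc (one a) = a
  firstArc (cons a _ _) = a

  lastArc : ∀ {u v as} → Path u v as → Fin m
  lastArc (one a) = a
  lastArc (cons a _ p) = lastArc p

  module _ (f : Fin m → ℕ) where

    Monotone : List (Fin m) → Set
    Monotone = Linked (λ a b → f a ≤ f b)

    minP : ∀ {u v as} → Path u v as → ℕ
    minP p = f (firstArc p)

    maxP : ∀ {u v as} → Path u v as → ℕ
    maxP p = f (lastArc p)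

    -- An i-fan of v w.r.t. g: paths P_1..P_i indexed by j : Fin i
    -- (P_j corresponds to index toℕ j, i.e. the paper's j is suc (toℕ j)).
    record Fan (g : Fin n → ℕ) (v : Fin n) (i : ℕ) : Set where
      field
        start    : Fin i → Fin n
        arcs     : Fin i → List (Fin m)
        isPath   : ∀ j → Path (start j) v (arcs j)
        mono     : ∀ j → Monotone (arcs j)
        lowerB   : ∀ j → suc (toℕ j) ≤ minP (isPath j)
        minMax   : ∀ j → minP (isPath j) ≤ maxP (isPath j)
        upperB   : ∀ j → maxP (isPath j) ≤ i
        startOK  : ∀ j → minP (isPath j) ≤ g (start j)
        disjoint : ∀ j l → j ≢ l → ∀ a → a ∈ arcs j → a ∈ arcs l → ⊥

    FanExtension : (s : Fin n) (k : ℕ) (g : Fin n → ℕ) → Set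
    FanExtension s k g =
      (∀ v → g v ≤ k) ×
      g s ≡ k ×
      (∀ v → v ≢ s → 0 < g v → Fan g v (g v)) ×
      (∀ (a : Fin m) → f a ≤ g (tl a) ⊎ (∃ λ b → hd b ≡ tl a × f b ≡ f a))

-- A fan of v with respect to g stays a fan with respect to any g' ≥ g, so the
-- pointwise maximum of two fan-extensions is again one: at each node the larger
-- of the two values comes with its fan, and raising g only weakens condition (ii).
-- There are finitely many candidates V → {0,…,k}, and being a fan-extension is
-- decidable, because in an acyclic graph a path never repeats an arc and so fans
-- range over a finite set.  Hence the join of all fan-extensions is the greatest
-- one.
module Submission where

open import Defs
open import Data.Nat using (ℕ; zero; suc; _≤_; _<_; _⊔_; s≤s; _≤?_; _<?_)
open import Data.Nat.Properties
  using (≤-trans; ≤-reflexive; ≮⇒≥; ⊔-sel; ⊔-lub; ⊔-idem; m≤m⊔n; m≤n⊔m; _≟_)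
open import Data.Fin using (Fin; toℕ; zero; suc) renaming (_≟_ to _≟ᶠ_; _<_ to _<ᶠ_)
open import Data.Fin.Properties using (all?; any?; pigeonhole)
open import Data.Vec.Functional using (Vector; zipWith) renaming (_∷_ to _∷ᵛ_)
open import Data.List
  using (List; []; _∷_; foldr; length; lookup; allFin; upTo; filter; cartesianProductWith)
open import Data.List.Membership.Propositional using (_∈_; find; lose)
open import Data.List.Membership.Propositional.Properties
  using (∈-cartesianProductWith⁺; ∈-allFin; ∈-upTo⁺; ∈-filter⁺; ∈-lookup)
open import Data.List.Relation.Unary.Any using (here; there)
import Data.List.Relation.Unary.Any as Any
open import Data.List.Relation.Unary.All using (All; []; _∷_)
import Data.List.Relation.Unary.All as All
open import Data.List.Relation.Unary.All.Properties using (¬Any⇒All¬; all-filter)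
open import Data.List.Relation.Unary.AllPairs using ([]; _∷_)
open import Data.List.Relation.Unary.Unique.Propositional using (Unique)
open import Data.List.Relation.Unary.Linked using (linked?)
open import Data.Product using (Σ; Σ-syntax; ∃; _×_; _,_; proj₁; proj₂; map₂)
open import Data.Sum using (_⊎_; inj₁; inj₂; map₁)
open import Data.Empty using (⊥; ⊥-elim)
open import Relation.Nullary using (Dec; yes; no)
open import Relation.Nullary.Decidable using (_×-dec_; _⊎-dec_; _→-dec_; ¬?; map′)
open import Relation.Unary using (Decidable)
open import Relation.Binary.PropositionalEquality
  using (_≡_; _≢_; _≗_; refl; sym; trans; cong₂; subst; subst₂)

module _ {a} {A : Set a} where

  functions : List A → (i : ℕ) → List (Vector A i)
  functions xs zero    = (λ ()) ∷ []
  functions xs (suc i) = cartesianProductWith _∷ᵛ_ xs (functions xs i)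

  functions-complete : ∀ {xs i} (F : Vector A i) → (∀ j → F j ∈ xs) →
                       ∃ λ G → G ∈ functions xs i × G ≗ F
  functions-complete {i = zero}  F F∈ = (λ ()) , here refl , λ ()
  functions-complete {i = suc i} F F∈ =
    let G , G∈ , G≗ = functions-complete (λ j → F (suc j)) (λ j → F∈ (suc j))
    in F zero ∷ᵛ G , ∈-cartesianProductWith⁺ _∷ᵛ_ (F∈ zero) G∈ ,
       λ { zero → refl ; (suc j) → G≗ j }

  listsUpTo : List A → ℕ → List (List A)
  listsUpTo xs zero    = [] ∷ []
  listsUpTo xs (suc l) = [] ∷ cartesianProductWith _∷_ xs (listsUpTo xs l)

  listsUpTo-complete : ∀ {xs} l {ys} → All (_∈ xs) ys → length ys ≤ l → ys ∈ listsUpTo xs l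
  listsUpTo-complete zero    []         _       = here refl
  listsUpTo-complete (suc l) []         _       = here refl
  listsUpTo-complete (suc l) (y∈ ∷ ys∈) (s≤s ≤l) =
    there (∈-cartesianProductWith⁺ _∷_ y∈ (listsUpTo-complete l ys∈ ≤l))

  ∃-function? : ∀ {p} {i} {P : Vector A i → Set p} (xs : List A) → Decidable P →
                (∀ {F G} → F ≗ G → P F → P G) → (∀ {F} → P F → ∀ j → F j ∈ xs) →
                Dec (∃ P)
  ∃-function? {i = i} xs P? P-resp P-range with Any.any? P? (functions xs i)
  ... | yes PG = let G , _ , pG = find PG in yes (G , pG)
  ... | no ¬PG = no λ (F , pF) →
        let G , G∈ , G≗F = functions-complete F (P-range pF)
        in ¬PG (lose G∈ (P-resp (λ j → sym (G≗F j)) pF))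

  Σ-dec-irrelevant : ∀ {b} {B : A → Set b} → Dec A → (∀ x → Dec (B x)) →
                     (∀ x y → B x → B y) → Dec (Σ A B)
  Σ-dec-irrelevant (no ¬x) B? B-irr = no λ (x , _) → ¬x x
  Σ-dec-irrelevant (yes x) B? B-irr with B? x
  ... | yes bx = yes (x , bx)
  ... | no ¬bx = no λ (y , by) → ¬bx (B-irr y x by)

module _ {n : ℕ} where

  ⨆ : Vector ℕ n → List (Vector ℕ n) → Vector ℕ n
  ⨆ g₀ = foldr (zipWith _⊔_) g₀

  ⨆-preserves : ∀ {p} {P : Vector ℕ n → Set p} → (∀ {g₁ g₂} → P g₁ → P g₂ → P (zipWith _⊔_ g₁ g₂)) →
                ∀ {g₀ Gs} → P g₀ → All P Gs → P (⨆ g₀ Gs)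
  ⨆-preserves P-⊔ P₀ []         = P₀
  ⨆-preserves P-⊔ P₀ (PG ∷ PGs) = P-⊔ PG (⨆-preserves P-⊔ P₀ PGs)

  ≤-⨆ : ∀ {g₀ G Gs} → G ∈ Gs → ∀ v → G v ≤ ⨆ g₀ Gs v
  ≤-⨆             (here refl) v = m≤m⊔n _ _
  ≤-⨆ {Gs = H ∷ _} (there G∈) v = ≤-trans (≤-⨆ G∈ v) (m≤n⊔m (H v) _)

  ⊔-closed⇒greatest : ∀ {p} {P : Vector ℕ n → Set p} (k : ℕ) → Decidable P →
                      (∀ {g g'} → g ≗ g' → P g → P g') →
                      (∀ {g₁ g₂} → P g₁ → P g₂ → P (zipWith _⊔_ g₁ g₂)) →
                      (∀ {g} → P g → ∀ v → g v ≤ k) →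
                      ∀ {g₀} → P g₀ → ∃ λ g* → P g* × (∀ g → P g → ∀ v → g v ≤ g* v)
  ⊔-closed⇒greatest {P = P} k P? P-resp P-⊔ P-bounded {g₀} P₀ =
    g* , ⨆-preserves P-⊔ P₀ (all-filter P? candidates) , below-g*
    where
    candidates = functions (upTo (suc k)) n
    g* = ⨆ g₀ (filter P? candidates)
    below-g* : ∀ g → P g → ∀ v → g v ≤ g* v
    below-g* g Pg v =
      let G , G∈ , G≗g = functions-complete g (λ u → ∈-upTo⁺ (s≤s (P-bounded Pg u)))
      in subst (_≤ g* v) (G≗g v) (≤-⨆ (∈-filter⁺ P? G∈ (P-resp (λ u → sym (G≗g u)) Pg)) v)

Unique⇒lookup-injective : ∀ {a} {A : Set a} {xs : List A} → Unique xs →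
                          ∀ {i j} → i <ᶠ j → lookup xs i ≢ lookup xs j
Unique⇒lookup-injective (x∉ ∷ _) {zero} {suc j} _ eq = All.lookup x∉ (∈-lookup j) eq
Unique⇒lookup-injective (_ ∷ u) {suc i} {suc j} (s≤s i<j) eq = Unique⇒lookup-injective u i<j eq

Unique⇒length≤ : ∀ {m} {xs : List (Fin m)} → Unique xs → length xs ≤ m
Unique⇒length≤ {m} {xs} u with m <? length xs
... | no m≮len = ≮⇒≥ m≮len
... | yes m<len = let i , j , i<j , eq = pigeonhole m<len (lookup xs)
                  in ⊥-elim (Unique⇒lookup-injective u i<j eq)

module _ {n m : ℕ} (tl hd : Fin m → Fin n) where

  firstArc-irrelevant : ∀ {u v u' v' as} (p : Path tl hd u v as) (q : Path tl hd u' v' as) →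
                        firstArc tl hd p ≡ firstArc tl hd q
  firstArc-irrelevant (one _)      (one _)      = refl
  firstArc-irrelevant (cons _ _ _) (cons _ _ _) = refl
  firstArc-irrelevant (one _)      (cons _ _ ())
  firstArc-irrelevant (cons _ _ ()) (one _)

  lastArc-irrelevant : ∀ {u v u' v' as} (p : Path tl hd u v as) (q : Path tl hd u' v' as) →
                       lastArc tl hd p ≡ lastArc tl hd q
  lastArc-irrelevant (one _)      (one _)      = refl
  lastArc-irrelevant (cons _ _ p) (cons _ _ q) = lastArc-irrelevant p q
  lastArc-irrelevant (one _)      (cons _ _ ())
  lastArc-irrelevant (cons _ _ ()) (one _)

  path? : ∀ u v as → Dec (Path tl hd u v as)
  path? u v [] = no λ ()
  path? u v (a ∷ []) with tl a ≟ᶠ u | hd a ≟ᶠ v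
  ... | yes refl | yes refl = yes (one a)
  ... | no tl≢u  | _        = no λ { (one _) → tl≢u refl ; (cons _ _ ()) }
  ... | yes _    | no hd≢v  = no λ { (one _) → hd≢v refl ; (cons _ _ ()) }
  path? u v (a ∷ b ∷ as) with tl a ≟ᶠ u | path? (hd a) v (b ∷ as)
  ... | yes refl | yes p  = yes (cons a refl p)
  ... | no tl≢u  | _      = no λ { (cons _ _ _) → tl≢u refl }
  ... | yes refl | no ¬p  = no λ { (cons _ refl p) → ¬p p }

  path-prefix : ∀ {u v as b} → Path tl hd u v as → b ∈ as → ∃ λ bs → Path tl hd u (hd b) bs
  path-prefix (one a)         (here refl) = _ , one a
  path-prefix (cons a _ _)    (here refl) = _ , one a
  path-prefix (cons a refl p) (there b∈)  =
    let bs , q = path-prefix p b∈ in a ∷ bs , cons a refl q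

  acyclic⇒path-unique : Acyclic tl hd → ∀ {u v as} → Path tl hd u v as → Unique as
  acyclic⇒path-unique acyclic (one a)         = [] ∷ []
  acyclic⇒path-unique acyclic (cons a refl p) =
    ¬Any⇒All¬ _ (λ a∈ → acyclic _ _ (proj₂ (path-prefix p a∈))) ∷ acyclic⇒path-unique acyclic p

  module _ (f : Fin m → ℕ) (g : Fin n → ℕ) (v : Fin n) (i : ℕ) where

    FanPathBounds : Fin i → Fin n → Fin m → Fin m → Set
    FanPathBounds j u first last =
      suc (toℕ j) ≤ f first × f first ≤ f last × f last ≤ i × f first ≤ g u

    FanPath : Fin i → List (Fin m) → Set
    FanPath j as = Σ[ u ∈ Fin n ] Σ[ p ∈ Path tl hd u v as ]
                     Monotone tl hd f as × FanPathBounds j u (firstArc tl hd p) (lastArc tl hd p)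

    ArcDisjoint : Vector (List (Fin m)) i → Set
    ArcDisjoint F = ∀ j l → j ≢ l → ∀ a → a ∈ F j → a ∈ F l → ⊥

    FanArcs : Vector (List (Fin m)) i → Set
    FanArcs F = (∀ j → FanPath j (F j)) × ArcDisjoint F

    fan⇒fanArcs : Fan tl hd f g v i → ∃ FanArcs
    fan⇒fanArcs fan =
      arcs , (λ j → start j , isPath j , mono j , lowerB j , minMax j , upperB j , startOK j) , disjoint
      where open Fan fan

    fanArcs⇒fan : ∃ FanArcs → Fan tl hd f g v i
    fanArcs⇒fan (F , paths , disjoint) = record
      { start    = λ j → proj₁ (paths j)
      ; arcs     = F
      ; isPath   = λ j → proj₁ (proj₂ (paths j))
      ; mono     = λ j → proj₁ (proj₂ (proj₂ (paths j)))
      ; lowerB   = λ j → proj₁ (bounds j)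
      ; minMax   = λ j → proj₁ (proj₂ (bounds j))
      ; upperB   = λ j → proj₁ (proj₂ (proj₂ (bounds j)))
      ; startOK  = λ j → proj₂ (proj₂ (proj₂ (bounds j)))
      ; disjoint = disjoint
      }
      where bounds = λ j → proj₂ (proj₂ (proj₂ (paths j)))

    fanPath? : ∀ j as → Dec (FanPath j as)
    fanPath? j as = any? λ u →
      Σ-dec-irrelevant (path? u v as) (λ p → linked? (λ a b → f a ≤? f b) as ×-dec bounds? u p)
        λ p q → map₂ (subst₂ (FanPathBounds j u) (firstArc-irrelevant p q) (lastArc-irrelevant p q))
      where
      bounds? : ∀ u {w} (p : Path tl hd u w as) →
                Dec (FanPathBounds j u (firstArc tl hd p) (lastArc tl hd p))
      bounds? u p = (suc (toℕ j) ≤? f _) ×-dec (f _ ≤? f _) ×-dec (f _ ≤? i) ×-dec (f _ ≤? g u)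

    arcDisjoint? : ∀ F → Dec (ArcDisjoint F)
    arcDisjoint? F = all? λ j → all? λ l → ¬? (j ≟ᶠ l) →-dec all? λ a →
                     (a ∈? F j) →-dec ((a ∈? F l) →-dec no λ ())
      where open import Data.List.Membership.DecPropositional (_≟ᶠ_ {m}) using (_∈?_)

    fanArcs-resp : ∀ {F G} → F ≗ G → FanArcs F → FanArcs G
    fanArcs-resp F≗G (paths , disjoint) =
      (λ j → subst (FanPath j) (F≗G j) (paths j)) ,
      λ j l j≢l a a∈Gj a∈Gl →
        disjoint j l j≢l a (subst (a ∈_) (sym (F≗G j)) a∈Gj) (subst (a ∈_) (sym (F≗G l)) a∈Gl)

    fanArcs-range : Acyclic tl hd → ∀ {F} → FanArcs F → ∀ j → F j ∈ listsUpTo (allFin m) m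
    fanArcs-range acyclic (paths , _) j =
      listsUpTo-complete m (All.universal ∈-allFin _) (Unique⇒length≤ unique)
      where unique = acyclic⇒path-unique acyclic (proj₁ (proj₂ (paths j)))

    fan? : Acyclic tl hd → Dec (Fan tl hd f g v i)
    fan? acyclic = map′ fanArcs⇒fan fan⇒fanArcs
      (∃-function? (listsUpTo (allFin m) m) fanArcs? fanArcs-resp (fanArcs-range acyclic))
      where
      fanArcs? : Decidable FanArcs
      fanArcs? F = all? (λ j → fanPath? j (F j)) ×-dec arcDisjoint? F

  fan-mono : ∀ {f g g' v i} → (∀ u → g u ≤ g' u) → Fan tl hd f g v i → Fan tl hd f g' v i
  fan-mono g≤g' fan = record
    { start = start ; arcs = arcs ; isPath = isPath ; mono = mono ; lowerB = lowerB ; minMax = minMax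
    ; upperB = upperB ; startOK = λ j → ≤-trans (startOK j) (g≤g' (start j)) ; disjoint = disjoint }
    where open Fan fan

  module _ (f : Fin m → ℕ) (s : Fin n) (k : ℕ) where

    fanExtension? : Acyclic tl hd → Decidable (FanExtension tl hd f s k)
    fanExtension? acyclic g =
      all? (λ v → g v ≤? k) ×-dec (g s ≟ k) ×-dec
      all? (λ v → ¬? (v ≟ᶠ s) →-dec ((0 <? g v) →-dec fan? f g v (g v) acyclic)) ×-dec
      all? (λ a → (f a ≤? g (tl a)) ⊎-dec any? (λ b → (hd b ≟ᶠ tl a) ×-dec (f b ≟ f a)))

    fanExtension-resp : ∀ {g g'} → g ≗ g' →
                        FanExtension tl hd f s k g → FanExtension tl hd f s k g'
    fanExtension-resp {g' = g'} g≗g' (≤k , s↦k , fans , arcCond) =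
      (λ v → subst (_≤ k) (g≗g' v) (≤k v)) ,
      trans (sym (g≗g' s)) s↦k ,
      (λ v v≢s 0<g'v → subst (Fan tl hd f g' v) (g≗g' v)
        (fan-mono (λ u → ≤-reflexive (g≗g' u)) (fans v v≢s (subst (0 <_) (sym (g≗g' v)) 0<g'v)))) ,
      λ a → map₁ (subst (f a ≤_) (g≗g' (tl a))) (arcCond a)

    fanExtension-⊔ : ∀ {g₁ g₂} → FanExtension tl hd f s k g₁ → FanExtension tl hd f s k g₂ →
                     FanExtension tl hd f s k (zipWith _⊔_ g₁ g₂)
    fanExtension-⊔ {g₁} {g₂} (≤k₁ , s↦k₁ , fans₁ , arcCond₁) (≤k₂ , s↦k₂ , fans₂ , arcCond₂) =
      (λ v → ⊔-lub (≤k₁ v) (≤k₂ v)) , trans (cong₂ _⊔_ s↦k₁ s↦k₂) (⊔-idem k) , fans , arcCond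
      where
      g = zipWith _⊔_ g₁ g₂
      fans : ∀ v → v ≢ s → 0 < g v → Fan tl hd f g v (g v)
      fans v v≢s 0<gv with ⊔-sel (g₁ v) (g₂ v)
      ... | inj₁ gv≡g₁v = subst (Fan tl hd f g v) (sym gv≡g₁v)
            (fan-mono (λ u → m≤m⊔n (g₁ u) (g₂ u)) (fans₁ v v≢s (subst (0 <_) gv≡g₁v 0<gv)))
      ... | inj₂ gv≡g₂v = subst (Fan tl hd f g v) (sym gv≡g₂v)
            (fan-mono (λ u → m≤n⊔m (g₁ u) (g₂ u)) (fans₂ v v≢s (subst (0 <_) gv≡g₂v 0<gv)))
      arcCond : ∀ a → f a ≤ g (tl a) ⊎ ∃ λ b → hd b ≡ tl a × f b ≡ f a
      arcCond a = map₁ (λ fa≤ → ≤-trans fa≤ (m≤m⊔n _ _)) (arcCond₁ a)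

mainTheorem6 : {n m : ℕ} (tl hd : Fin m → Fin n) (s : Fin n) (k : ℕ) (f : Fin m → ℕ) →
    Acyclic tl hd → SingleSource tl hd s → (∀ a → f a ≤ k) →
    (∃ λ (g : Fin n → ℕ) → FanExtension tl hd f s k g) →
    ∃ λ (gstar : Fin n → ℕ) → FanExtension tl hd f s k gstar ×
      (∀ (g : Fin n → ℕ) → FanExtension tl hd f s k g → ∀ v → g v ≤ gstar v)
mainTheorem6 tl hd s k f acyclic _ _ (g₀ , g₀-ext) =
  ⊔-closed⇒greatest k (fanExtension? tl hd f s k acyclic)
    (fanExtension-resp tl hd f s k) (fanExtension-⊔ tl hd f s k) proj₁ g₀-ext
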